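{- Let $a\in\mathbb{N}$ with $a\geq 3$, and let $S(a)$ be the submonoid of $(\mathbb{N},+)$ generated by $\{f_a+f_n\mid n\in\mathbb{N}\}$. Then $\mathrm{g}(S(a))=\sum_{i=1}^{\lfloor (a-1)/2\rfloor} i\binom{a-1-i}{i}$.
   Context: $\{f_n\}$ is the Fibonacci sequence ($f_0=0$, $f_1=1$, $f_{n+2}=f_{n+1}+f_n$). $\mathrm{g}(S)$, the genus of a numerical semigroup $S$, is the cardinality of $\mathbb{N}\setminus S$. -}

module Defs where

open import Data.Nat using (ℕ; zero; suc; _+_; _*_; _∸_; _/_)
open import Data.Nat.Combinatorics using (_C_)
open import Data.List using (List; map; length)
open import Data.Nat.ListAction using (sum)
open import Data.List.Relation.Unary.Unique.Propositional using (Unique)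
open import Data.List.Membership.Propositional using (_∈_)
open import Data.Product using (Σ; _×_)
open import Function.Bundles using (_⇔_)
open import Relation.Nullary using (¬_)
open import Relation.Binary.PropositionalEquality using (_≡_)

fib : ℕ → ℕ
fib zero = zero
fib (suc zero) = suc zero
fib (suc (suc n)) = fib (suc n) + fib n

InS : ℕ → ℕ → Set
InS a x = Σ (List ℕ) λ ns → sum (map (λ n → fib a + fib n) ns) ≡ x

HasGenus : (ℕ → Set) → ℕ → Set
HasGenus P g = Σ (List ℕ) λ L → Unique L × ((x : ℕ) → (x ∈ L ⇔ (¬ P x))) × length L ≡ g

sumFrom1 : ℕ → (ℕ → ℕ) → ℕ
sumFrom1 zero h = zero
sumFrom1 (suc k) h = sumFrom1 k h + h (suc k)

genusFormula : ℕ → ℕ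
genusFormula a = sumFrom1 ((a ∸ 1) / 2) (λ i → i * ((a ∸ 1 ∸ i) C i))

-- Let m = f a and write x = q·m + r with r < m. Greedily writing r as a sum of
-- zeck a r numbers f n with n < a shows zeck a r · m + r = Σ (m + f n) ∈ S(a).
-- Conversely, adding a generator m + f n to x never lets zeck a (x mod m) exceed
-- ⌊x/m⌋ (for n ≥ a use f n = f (n-a+1)·m + f (n-a)·f (a-1)). So x ∈ S(a) iff
-- zeck a r ≤ q, and the gaps of S(a) in the class of r are q·m + r with q < zeck a r:
-- the genus is T a = Σ_{r < f a} zeck a r. Splitting this sum at f (a-1) gives
-- T (b+2) = T (b+1) + f b + T b, which Pascal's rule shows is also satisfied by
-- W n = Σ_j j·C(n-j, j) (using Σ_j C(n-j, j) = f (n+1)); hence T a = W (a-1).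

{-# OPTIONS --safe #-}
module Submission where

open import Defs
open import Data.Nat
open import Data.Nat.Properties
open import Data.Nat.DivMod
open import Data.Nat.Combinatorics
open import Data.Nat.ListAction using (sum)
open import Data.Nat.ListAction.Properties using (sum-++)
open import Data.Nat.Solver using (module +-*-Solver)
open import Data.List using (List; []; _∷_; map; length; _++_; replicate; upTo)
open import Data.List.Properties using (map-++; length-++; length-map; length-upTo)
open import Data.List.Membership.Propositional using (_∈_)
open import Data.List.Membership.Propositional.Properties
  using (∈-++⁺ˡ; ∈-++⁺ʳ; ∈-++⁻; ∈-map⁺; ∈-map⁻; ∈-upTo⁺; ∈-upTo⁻)
open import Data.List.Relation.Unary.Unique.Propositional using (Unique)
open import Data.List.Relation.Unary.Unique.Propositional.Properties using (++⁺; map⁺; upTo⁺)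
import Data.List.Relation.Unary.AllPairs as AllPairs
open import Data.Bool using (true; false; T; if_then_else_)
open import Data.Empty using (⊥-elim)
open import Data.Product using (Σ; _×_; _,_; proj₁)
open import Data.Sum using (inj₁; inj₂)
open import Function.Bundles using (mk⇔)
open import Relation.Binary.Definitions using (tri<; tri≈; tri>)
open import Relation.Binary.PropositionalEquality
open import Relation.Nullary using (¬_; yes; no)

open +-*-Solver

m∸n<o : ∀ {m n o} → n ≤ m → m < n + o → m ∸ n < o
m∸n<o {m} {n} {o} n≤m m<n+o = subst (m ∸ n <_) (m+n∸m≡n n o) (∸-monoˡ-< m<n+o n≤m)

m≡n+o⇒m∸o≡n : ∀ {m n o} → m ≡ n + o → m ∸ o ≡ n
m≡n+o⇒m∸o≡n {n = n} {o} refl = m+n∸n≡m n o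

fib-≤-suc : ∀ n → fib n ≤ fib (suc n)
fib-≤-suc zero = z≤n
fib-≤-suc (suc n) = m≤m+n (fib (suc n)) (fib n)

fib-mono : ∀ {m n} → m ≤ n → fib m ≤ fib n
fib-mono m≤n with m≤n⇒m<n∨m≡n m≤n
... | inj₂ refl = ≤-refl
... | inj₁ (s≤s {n = n-1} m≤n-1) = ≤-trans (fib-mono m≤n-1) (fib-≤-suc n-1)

fib-pos : ∀ n → 0 < fib (suc n)
fib-pos n = fib-mono {1} {suc n} (s≤s z≤n)

fib-+ : ∀ j t → fib (j + suc t) ≡ fib (suc j) * fib (suc t) + fib j * fib t
fib-+ zero t = sym (trans (+-identityʳ _) (+-identityʳ _))
fib-+ (suc zero) t = cong₂ _+_ (sym (+-identityʳ (fib (suc t)))) (sym (+-identityʳ (fib t)))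
fib-+ (suc (suc j)) t = trans (cong₂ _+_ (fib-+ (suc j) t) (fib-+ j t))
  (solve 4 (λ A B F f → (A :+ B) :* F :+ A :* f :+ (A :* F :+ B :* f)
                      := ((A :+ B) :+ A) :* F :+ (A :+ B) :* f) refl (fib (suc j)) (fib j) (fib (suc t)) (fib t))

-- zeck a r counts the terms of the greedy (Zeckendorf) representation of r by
-- f 1, …, f (a - 1); it is meaningful for r < f a only.
zeck : ℕ → ℕ → ℕ
zeck zero r = 0
zeck (suc zero) r = 0
zeck (suc (suc b)) r =
  if r <ᵇ fib (suc b) then zeck (suc b) r else suc (zeck b (r ∸ fib (suc b)))

zeck-< : ∀ b r → r < fib (suc b) → zeck (suc (suc b)) r ≡ zeck (suc b) r
zeck-< b r r<F with r <ᵇ fib (suc b) in r<ᵇF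
... | true = refl
... | false = ⊥-elim (subst T r<ᵇF (<⇒<ᵇ r<F))

zeck-≥ : ∀ b r → fib (suc b) ≤ r → zeck (suc (suc b)) r ≡ suc (zeck b (r ∸ fib (suc b)))
zeck-≥ b r F≤r with r <ᵇ fib (suc b) in r<ᵇF
... | true = ⊥-elim (<⇒≱ (<ᵇ⇒< r (fib (suc b)) (subst T (sym r<ᵇF) _)) F≤r)
... | false = refl

zeck-suc : ∀ a r → r < fib a → zeck (suc a) r ≡ zeck a r
zeck-suc (suc b) r r<F = zeck-< b r r<F

zeck-0 : ∀ a → zeck a 0 ≡ 0
zeck-0 zero = refl
zeck-0 (suc zero) = refl
zeck-0 (suc (suc b)) = trans (zeck-< b 0 (fib-pos b)) (zeck-0 (suc b))

ZeckRepresentation : ℕ → Set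
ZeckRepresentation a = ∀ r → r < fib a → Σ (List ℕ) λ ns → length ns ≡ zeck a r × sum (map fib ns) ≡ r

zeck-represents-step : ∀ b → ZeckRepresentation b → ZeckRepresentation (suc b) →
                       ZeckRepresentation (suc (suc b))
zeck-represents-step b rep-b rep-sb r r<f with fib (suc b) ≤? r
... | no F≰r =
  let ns , len , total = rep-sb r (≰⇒> F≰r)
  in ns , trans len (sym (zeck-< b r (≰⇒> F≰r))) , total
... | yes F≤r =
  let ns , len , total = rep-b (r ∸ fib (suc b)) (m∸n<o F≤r r<f)
  in suc b ∷ ns , trans (cong suc len) (sym (zeck-≥ b r F≤r)) ,
     trans (cong (fib (suc b) +_) total) (m+[n∸m]≡n F≤r)

zeck-represents : ∀ a → ZeckRepresentation a
zeck-represents (suc zero) zero _ = [] , refl , refl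
zeck-represents (suc zero) (suc r) (s≤s ())
zeck-represents (suc (suc b)) = zeck-represents-step b (zeck-represents b) (zeck-represents (suc b))

-- For r < f a and n < a, adding f n to q · f a + r raises q + zeck a r by at most one;
-- ZeckWrapFib is the case where the residue r + f n overflows f a.
ZeckAddFib : ℕ → Set
ZeckAddFib a = ∀ r n → r + fib n < fib a → zeck a (r + fib n) ≤ suc (zeck a r)

ZeckWrapFib : ℕ → Set
ZeckWrapFib a = ∀ r n → r < fib a → n < a → fib a ≤ r + fib n →
                zeck a ((r + fib n) ∸ fib a) ≤ zeck a r

zeck-+fib-above : ∀ b r n → fib (suc b) ≤ r → r + fib n < fib (suc (suc b)) → ZeckAddFib b →
                  zeck (suc (suc b)) (r + fib n) ≤ suc (zeck (suc (suc b)) r)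
zeck-+fib-above b r n F≤r bound add-b = begin
  zeck (suc (suc b)) (r + fib n)  ≡⟨ zeck-≥ b (r + fib n) F≤r+f ⟩
  suc (zeck b (r + fib n ∸ F))    ≡⟨ cong (λ x → suc (zeck b x)) (+-∸-comm (fib n) F≤r) ⟩
  suc (zeck b (r ∸ F + fib n))    ≤⟨ s≤s (add-b (r ∸ F) n below) ⟩
  suc (suc (zeck b (r ∸ F)))      ≡⟨ cong suc (sym (zeck-≥ b r F≤r)) ⟩
  suc (zeck (suc (suc b)) r)      ∎
  where
  open ≤-Reasoning
  F : ℕ
  F = fib (suc b)
  F≤r+f : F ≤ r + fib n
  F≤r+f = ≤-trans F≤r (m≤m+n r (fib n))
  below : r ∸ F + fib n < fib b
  below = subst (_< fib b) (+-∸-comm (fib n) F≤r) (m∸n<o F≤r+f bound)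

zeck-+fib-across : ∀ b r n → r < fib (suc b) → fib (suc b) ≤ r + fib n → r + fib n < fib (suc (suc b)) →
                   ZeckWrapFib (suc b) → zeck b (r + fib n ∸ fib (suc b)) ≤ zeck (suc b) r
zeck-+fib-across b r n r<F F≤r+f bound wrap-sb with <-cmp n (suc b)
... | tri< n<sb _ _ = begin
  zeck b u        ≡⟨ sym (zeck-suc b u u<f) ⟩
  zeck (suc b) u  ≤⟨ wrap-sb r n r<F n<sb F≤r+f ⟩
  zeck (suc b) r  ∎
  where
  open ≤-Reasoning
  u : ℕ
  u = r + fib n ∸ fib (suc b)
  u<f : u < fib b
  u<f = m∸n<o F≤r+f bound
... | tri≈ _ refl _ = begin
  zeck b (r + fib (suc b) ∸ fib (suc b))  ≡⟨ cong (zeck b) (m+n∸n≡m r (fib (suc b))) ⟩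
  zeck b r                                ≡⟨ sym (zeck-suc b r r<f) ⟩
  zeck (suc b) r                          ∎
  where
  open ≤-Reasoning
  r<f : r < fib b
  r<f = subst (_< fib b) (m+n∸n≡m r (fib (suc b))) (m∸n<o F≤r+f bound)
... | tri> _ _ sb<n = ⊥-elim (<⇒≱ bound (≤-trans (fib-mono sb<n) (m≤n+m (fib n) r)))

zeck-+fib-step : ∀ b → ZeckAddFib b → ZeckAddFib (suc b) → ZeckWrapFib (suc b) → ZeckAddFib (suc (suc b))
zeck-+fib-step b add-b add-sb wrap-sb r n bound with fib (suc b) ≤? r | fib (suc b) ≤? r + fib n
... | yes F≤r | _ = zeck-+fib-above b r n F≤r bound add-b
... | no F≰r | no F≰r+f = begin
  zeck (suc (suc b)) (r + fib n)  ≡⟨ zeck-< b (r + fib n) (≰⇒> F≰r+f) ⟩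
  zeck (suc b) (r + fib n)        ≤⟨ add-sb r n (≰⇒> F≰r+f) ⟩
  suc (zeck (suc b) r)            ≡⟨ cong suc (sym (zeck-< b r (≰⇒> F≰r))) ⟩
  suc (zeck (suc (suc b)) r)      ∎
  where open ≤-Reasoning
... | no F≰r | yes F≤r+f = begin
  zeck (suc (suc b)) (r + fib n)        ≡⟨ zeck-≥ b (r + fib n) F≤r+f ⟩
  suc (zeck b (r + fib n ∸ fib (suc b))) ≤⟨ s≤s (zeck-+fib-across b r n (≰⇒> F≰r) F≤r+f bound wrap-sb) ⟩
  suc (zeck (suc b) r)                  ≡⟨ cong suc (sym (zeck-< b r (≰⇒> F≰r))) ⟩
  suc (zeck (suc (suc b)) r)            ∎
  where open ≤-Reasoning

zeck-wrap-above-top : ∀ c r → fib (suc c) ≤ r → r < fib (suc (suc c)) → ZeckAddFib (suc c) →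
                      zeck (suc (suc c)) (r + fib (suc c) ∸ fib (suc (suc c))) ≤ zeck (suc (suc c)) r
zeck-wrap-above-top zero zero () _ _
zeck-wrap-above-top zero (suc r) _ (s≤s ()) _
zeck-wrap-above-top (suc c′) r F≤r bound add-c = begin
  zeck A (r + F ∸ (F + f))  ≡⟨ cong (zeck A) wrapped ⟩
  zeck A (s + f′)           ≡⟨ zeck-< c (s + f′) s+f′<F ⟩
  zeck (suc c) (s + f′)     ≤⟨ add-c s c′ s+f′<F ⟩
  suc (zeck (suc c) s)      ≡⟨ cong suc (zeck-suc c s s<f) ⟩
  suc (zeck c s)            ≡⟨ sym (zeck-≥ c r F≤r) ⟩
  zeck A r                  ∎
  where
  open ≤-Reasoning
  c A F f f′ s : ℕ
  c = suc c′
  A = suc (suc c)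
  F = fib (suc c)
  f = fib c
  f′ = fib c′
  s = r ∸ F
  s<f : s < f
  s<f = m∸n<o F≤r bound
  s+f′<F : s + f′ < F
  s+f′<F = +-monoˡ-< f′ s<f
  wrapped : r + F ∸ (F + f) ≡ s + f′
  wrapped = m≡n+o⇒m∸o≡n (trans (cong (_+ F) (sym (m∸n+n≡m F≤r)))
    (solve 3 (λ s x y → s :+ (x :+ y) :+ (x :+ y) := s :+ y :+ ((x :+ y) :+ x)) refl s f f′))

zeck-wrap-above-next : ∀ c r → fib (suc c) ≤ r → r < fib (suc (suc c)) →
                       zeck (suc (suc c)) (r + fib c ∸ fib (suc (suc c))) ≤ zeck (suc (suc c)) r
zeck-wrap-above-next c r F≤r bound = begin
  zeck A (r + f ∸ (F + f))  ≡⟨ cong (zeck A) wrapped ⟩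
  zeck A s                  ≡⟨ zeck-< c s (<-≤-trans s<f (fib-≤-suc c)) ⟩
  zeck (suc c) s            ≡⟨ zeck-suc c s s<f ⟩
  zeck c s                  ≤⟨ n≤1+n _ ⟩
  suc (zeck c s)            ≡⟨ sym (zeck-≥ c r F≤r) ⟩
  zeck A r                  ∎
  where
  open ≤-Reasoning
  A F f s : ℕ
  A = suc (suc c)
  F = fib (suc c)
  f = fib c
  s = r ∸ F
  s<f : s < f
  s<f = m∸n<o F≤r bound
  wrapped : r + f ∸ (F + f) ≡ s
  wrapped = m≡n+o⇒m∸o≡n (trans (cong (_+ f) (sym (m∸n+n≡m F≤r))) (+-assoc s F f))

zeck-wrap-above-lower : ∀ c r n → fib (suc c) ≤ r → r < fib (suc (suc c)) → n < c →
                        fib (suc (suc c)) ≤ r + fib n → ZeckWrapFib c →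
                        zeck (suc (suc c)) (r + fib n ∸ fib (suc (suc c))) ≤ zeck (suc (suc c)) r
zeck-wrap-above-lower c r n F≤r bound n<c overflow wrap-c = begin
  zeck A (r + fib n ∸ (F + f))  ≡⟨ cong (zeck A) wrapped ⟩
  zeck A w                      ≡⟨ zeck-< c w (<-≤-trans w<f (fib-≤-suc c)) ⟩
  zeck (suc c) w                ≡⟨ zeck-suc c w w<f ⟩
  zeck c w                      ≤⟨ wrap-c s n s<f n<c f≤s+fn ⟩
  zeck c s                      ≤⟨ n≤1+n _ ⟩
  suc (zeck c s)                ≡⟨ sym (zeck-≥ c r F≤r) ⟩
  zeck A r                      ∎
  where
  open ≤-Reasoning
  A F f s : ℕ
  A = suc (suc c)
  F = fib (suc c)
  f = fib c
  s = r ∸ F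
  s<f : s < f
  s<f = m∸n<o F≤r bound
  r≡s+F : r ≡ s + F
  r≡s+F = sym (m∸n+n≡m F≤r)
  f≤s+fn : f ≤ s + fib n
  f≤s+fn = +-cancelˡ-≤ F f (s + fib n) (≤-trans overflow (≤-reflexive (trans (cong (_+ fib n) r≡s+F)
    (solve 3 (λ x y z → x :+ y :+ z := y :+ (x :+ z)) refl s F (fib n)))))
  w : ℕ
  w = s + fib n ∸ f
  w<f : w < f
  w<f = <-≤-trans (m∸n<o f≤s+fn (+-monoˡ-< (fib n) s<f)) (fib-mono (<⇒≤ n<c))
  wrapped : r + fib n ∸ (F + f) ≡ w
  wrapped = m≡n+o⇒m∸o≡n (begin-equality
    r + fib n      ≡⟨ cong (_+ fib n) r≡s+F ⟩
    s + F + fib n  ≡⟨ solve 3 (λ x y z → x :+ y :+ z := x :+ z :+ y) refl s F (fib n) ⟩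
    s + fib n + F  ≡⟨ cong (_+ F) (sym (m∸n+n≡m f≤s+fn)) ⟩
    w + f + F      ≡⟨ solve 3 (λ x y z → x :+ y :+ z := x :+ (z :+ y)) refl w f F ⟩
    w + (F + f)    ∎)

zeck-wrap-below : ∀ c r → r < fib (suc c) → fib (suc (suc c)) ≤ r + fib (suc c) →
                  zeck (suc (suc c)) (r + fib (suc c) ∸ fib (suc (suc c))) ≤ zeck (suc (suc c)) r
zeck-wrap-below zero zero _ _ = ≤-refl
zeck-wrap-below zero (suc r) (s≤s ()) _
zeck-wrap-below (suc c′) r r<F overflow = begin
  zeck A (r + F ∸ (F + f))  ≡⟨ cong (zeck A) wrapped ⟩
  zeck A u                  ≡⟨ zeck-< c u (<-≤-trans u<f′ (≤-trans (fib-≤-suc c′) (fib-≤-suc c))) ⟩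
  zeck (suc c) u            ≡⟨ zeck-suc c u (<-≤-trans u<f′ (fib-≤-suc c′)) ⟩
  zeck c u                  ≡⟨ zeck-suc c′ u u<f′ ⟩
  zeck c′ u                 ≤⟨ n≤1+n _ ⟩
  suc (zeck c′ u)           ≡⟨ sym (zeck-≥ c′ r f≤r) ⟩
  zeck (suc c) r            ≡⟨ sym (zeck-< c r r<F) ⟩
  zeck A r                  ∎
  where
  open ≤-Reasoning
  c A F f : ℕ
  c = suc c′
  A = suc (suc c)
  F = fib (suc c)
  f = fib c
  f≤r : f ≤ r
  f≤r = +-cancelˡ-≤ F f r (≤-trans overflow (≤-reflexive (+-comm r F)))
  u : ℕ
  u = r ∸ f
  u<f′ : u < fib c′
  u<f′ = m∸n<o f≤r r<F
  wrapped : r + F ∸ (F + f) ≡ u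
  wrapped = m≡n+o⇒m∸o≡n (trans (cong (_+ F) (sym (m∸n+n≡m f≤r)))
    (solve 3 (λ x y z → x :+ y :+ z := x :+ (z :+ y)) refl u f F))

zeck-wrap-step : ∀ c → ZeckAddFib (suc c) → ZeckWrapFib c → ZeckWrapFib (suc (suc c))
zeck-wrap-step c add-sc wrap-c r n bound n<a overflow
  with fib (suc c) ≤? r | m≤n⇒m<n∨m≡n (s≤s⁻¹ n<a)
... | yes F≤r | inj₂ refl = zeck-wrap-above-top c r F≤r bound add-sc
... | yes F≤r | inj₁ n<sc with m≤n⇒m<n∨m≡n (s≤s⁻¹ n<sc)
...   | inj₂ refl = zeck-wrap-above-next c r F≤r bound
...   | inj₁ n<c = zeck-wrap-above-lower c r n F≤r bound n<c overflow wrap-c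
zeck-wrap-step c add-sc wrap-c r n bound n<a overflow | no F≰r | inj₂ refl =
  zeck-wrap-below c r (≰⇒> F≰r) overflow
zeck-wrap-step c add-sc wrap-c r n bound n<a overflow | no F≰r | inj₁ n<sc =
  ⊥-elim (<⇒≱ (+-mono-<-≤ (≰⇒> F≰r) (fib-mono (s≤s⁻¹ n<sc))) overflow)

zeck-+fib : ∀ a → ZeckAddFib a
zeck-wrap : ∀ a → ZeckWrapFib a

zeck-+fib zero r n ()
zeck-+fib (suc zero) r n _ = z≤n
zeck-+fib (suc (suc b)) = zeck-+fib-step b (zeck-+fib b) (zeck-+fib (suc b)) (zeck-wrap (suc b))

zeck-wrap zero r n ()
zeck-wrap (suc zero) r n _ _ _ = z≤n
zeck-wrap (suc (suc c)) = zeck-wrap-step c (zeck-+fib (suc c)) (zeck-wrap c)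

sumBelow : ℕ → (ℕ → ℕ) → ℕ
sumBelow zero h = 0
sumBelow (suc n) h = sumBelow n h + h n

sumBelow-cong : ∀ n h h′ → (∀ i → i < n → h i ≡ h′ i) → sumBelow n h ≡ sumBelow n h′
sumBelow-cong zero h h′ h≗h′ = refl
sumBelow-cong (suc n) h h′ h≗h′ =
  cong₂ _+_ (sumBelow-cong n h h′ (λ i i<n → h≗h′ i (m<n⇒m<1+n i<n))) (h≗h′ n ≤-refl)

sumBelow-+ : ∀ n h h′ → sumBelow n (λ i → h i + h′ i) ≡ sumBelow n h + sumBelow n h′
sumBelow-+ zero h h′ = refl
sumBelow-+ (suc n) h h′ = trans (cong (_+ (h n + h′ n)) (sumBelow-+ n h h′))
  (solve 4 (λ A B C D → A :+ B :+ (C :+ D) := A :+ C :+ (B :+ D))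
           refl (sumBelow n h) (sumBelow n h′) (h n) (h′ n))

sumBelow-suc : ∀ n h → sumBelow n (λ i → suc (h i)) ≡ n + sumBelow n h
sumBelow-suc zero h = refl
sumBelow-suc (suc n) h = trans (cong (_+ suc (h n)) (sumBelow-suc n h))
  (solve 3 (λ N S H → N :+ S :+ (con 1 :+ H) := con 1 :+ N :+ (S :+ H)) refl n (sumBelow n h) (h n))

sumBelow-shift : ∀ n h → sumBelow (suc n) h ≡ h 0 + sumBelow n (λ i → h (suc i))
sumBelow-shift zero h = +-comm 0 (h 0)
sumBelow-shift (suc n) h = trans (cong (_+ h (suc n)) (sumBelow-shift n h)) (+-assoc (h 0) _ _)

sumBelow-split : ∀ n l h → sumBelow (l + n) h ≡ sumBelow l h + sumBelow n (λ i → h (l + i))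
sumBelow-split zero l h = trans (cong (λ x → sumBelow x h) (+-identityʳ l)) (sym (+-identityʳ _))
sumBelow-split (suc n) l h = trans (cong (λ x → sumBelow x h) (+-suc l n))
  (trans (cong (_+ h (l + n)) (sumBelow-split n l h)) (+-assoc (sumBelow l h) _ _))

sumBelow-last-0 : ∀ n h → h n ≡ 0 → sumBelow (suc n) h ≡ sumBelow n h
sumBelow-last-0 n h hn≡0 = trans (cong (sumBelow n h +_) hn≡0) (+-identityʳ _)

sumBelow-tail-0 : ∀ l n h → l ≤ n → (∀ i → l ≤ i → h i ≡ 0) → sumBelow n h ≡ sumBelow l h
sumBelow-tail-0 l zero h z≤n tail-0 = refl
sumBelow-tail-0 l (suc n) h l≤1+n tail-0 with m≤n⇒m<n∨m≡n l≤1+n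
... | inj₂ refl = refl
... | inj₁ l<1+n =
  trans (sumBelow-last-0 n h (tail-0 n (s≤s⁻¹ l<1+n))) (sumBelow-tail-0 l n h (s≤s⁻¹ l<1+n) tail-0)

module Apery (k : ℕ) where

  a : ℕ
  a = suc (suc (suc k))

  m : ℕ
  m = fib a

  m>0 : 0 < m
  m>0 = fib-pos (suc (suc k))

  instance
    m≢0 : NonZero m
    m≢0 = >-nonZero m>0

  gen : ℕ → ℕ
  gen n = m + fib n

  sum-gen : ∀ ns → sum (map gen ns) ≡ length ns * m + sum (map fib ns)
  sum-gen [] = refl
  sum-gen (n ∷ ns) = trans (cong (gen n +_) (sum-gen ns))
    (solve 4 (λ M f L S → (M :+ f) :+ (L :+ S) := (M :+ L) :+ (f :+ S))
             refl m (fib n) (length ns * m) (sum (map fib ns)))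

  sum-gen-replicate-0 : ∀ j → sum (map gen (replicate j 0)) ≡ j * m
  sum-gen-replicate-0 zero = refl
  sum-gen-replicate-0 (suc j) = cong₂ _+_ (+-identityʳ m) (sum-gen-replicate-0 j)

  zeck≤quot⇒InS : ∀ q r → r < m → zeck a r ≤ q → InS a (q * m + r)
  zeck≤quot⇒InS q r r<m zeck≤q =
    let ns , len , total = zeck-represents a r r<m
        padding = replicate (q ∸ zeck a r) 0
    in padding ++ ns , (begin
      sum (map gen (padding ++ ns))
        ≡⟨ cong sum (map-++ gen padding ns) ⟩
      sum (map gen padding ++ map gen ns)
        ≡⟨ sum-++ (map gen padding) (map gen ns) ⟩
      sum (map gen padding) + sum (map gen ns)
        ≡⟨ cong₂ _+_ (sum-gen-replicate-0 (q ∸ zeck a r)) (sum-gen ns) ⟩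
      (q ∸ zeck a r) * m + (length ns * m + sum (map fib ns))
        ≡⟨ cong₂ (λ l t → (q ∸ zeck a r) * m + (l * m + t)) len total ⟩
      (q ∸ zeck a r) * m + (zeck a r * m + r)
        ≡⟨ sym (+-assoc ((q ∸ zeck a r) * m) _ r) ⟩
      (q ∸ zeck a r) * m + zeck a r * m + r
        ≡⟨ cong (_+ r) (sym (*-distribʳ-+ m (q ∸ zeck a r) (zeck a r))) ⟩
      (q ∸ zeck a r + zeck a r) * m + r
        ≡⟨ cong (λ x → x * m + r) (m∸n+n≡m zeck≤q) ⟩
      q * m + r ∎)
    where open ≡-Reasoning

  -- y = q·f a + r lies at most e multiples of f a below zeck a r · f a + r,
  -- the least element of S(a) in the residue class of r.
  AboveApery : ℕ → ℕ → Set
  AboveApery e y = Σ ℕ λ q → Σ ℕ λ r → r < m × y ≡ q * m + r × zeck a r ≤ q + e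

  fib<m : ∀ n → n < a → fib n < m
  fib<m n (s≤s n≤a-1) = ≤-<-trans (fib-mono n≤a-1) (m<m+n (fib (suc (suc k))) (fib-pos k))

  aboveApery-+fib : ∀ e y n → n < a → AboveApery e y → AboveApery (suc e) (y + fib n)
  aboveApery-+fib e y n n<a (q , r , r<m , y≡ , zeck≤) with r + fib n <? m
  ... | yes r+f<m = q , r + fib n , r+f<m , trans (cong (_+ fib n) y≡) (+-assoc (q * m) r (fib n)) ,
        ≤-trans (zeck-+fib a r n r+f<m) (≤-trans (s≤s zeck≤) (≤-reflexive (sym (+-suc q e))))
  ... | no r+f≮m = suc q , w , w<m , y+f≡ ,
        ≤-trans (zeck-wrap a r n r<m n<a overflow) (≤-trans zeck≤ (+-mono-≤ (n≤1+n q) (n≤1+n e)))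
    where
    overflow : m ≤ r + fib n
    overflow = ≮⇒≥ r+f≮m
    w : ℕ
    w = r + fib n ∸ m
    w<m : w < m
    w<m = m∸n<o overflow (+-mono-< r<m (fib<m n n<a))
    y+f≡ : y + fib n ≡ suc q * m + w
    y+f≡ = begin
      y + fib n        ≡⟨ trans (cong (_+ fib n) y≡) (+-assoc (q * m) r (fib n)) ⟩
      q * m + (r + fib n) ≡⟨ cong (q * m +_) (sym (m∸n+n≡m overflow)) ⟩
      q * m + (w + m)  ≡⟨ solve 3 (λ Q W M → Q :+ (W :+ M) := M :+ Q :+ W) refl (q * m) w m ⟩
      m + q * m + w    ∎
      where open ≡-Reasoning

  aboveApery-+m : ∀ e y → AboveApery (suc e) y → AboveApery e (y + m)
  aboveApery-+m e y (q , r , r<m , y≡ , zeck≤) = suc q , r , r<m ,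
    trans (cong (_+ m) y≡) (solve 3 (λ Q R M → Q :+ R :+ M := M :+ Q :+ R) refl (q * m) r m) ,
    ≤-trans zeck≤ (≤-reflexive (+-suc q e))

  aboveApery-+*m : ∀ c e y → AboveApery (c + e) y → AboveApery e (y + c * m)
  aboveApery-+*m zero e y above = subst (AboveApery e) (sym (+-identityʳ y)) above
  aboveApery-+*m (suc c) e y above = subst (AboveApery e) (+-assoc y m (c * m))
    (aboveApery-+*m c e (y + m) (aboveApery-+m (c + e) y above))

  aboveApery-+*fib : ∀ d e y n → n < a → AboveApery e y → AboveApery (d + e) (y + d * fib n)
  aboveApery-+*fib zero e y n _ above = subst (AboveApery e) (sym (+-identityʳ y)) above
  aboveApery-+*fib (suc d) e y n n<a above = subst (AboveApery (suc d + e))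
    (solve 3 (λ Y D F → Y :+ D :+ F := Y :+ (F :+ D)) refl y (d * fib n) (fib n))
    (aboveApery-+fib (d + e) (y + d * fib n) n n<a (aboveApery-+*fib d e y n n<a above))

  aboveApery-weaken : ∀ {e e′ y} → e ≤ e′ → AboveApery e y → AboveApery e′ y
  aboveApery-weaken e≤e′ (q , r , r<m , y≡ , zeck≤) =
    q , r , r<m , y≡ , ≤-trans zeck≤ (+-monoʳ-≤ q e≤e′)

  aboveApery-+gen : ∀ e y n → AboveApery e y → AboveApery e (y + gen n)
  aboveApery-+gen e y n above with n <? a
  ... | yes n<a = subst (AboveApery e) (solve 3 (λ Y F M → Y :+ F :+ M := Y :+ (M :+ F)) refl y (fib n) m)
                    (aboveApery-+m e (y + fib n) (aboveApery-+fib e y n n<a above))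
  ... | no n≮a = subst (AboveApery e) y+gen≡
                   (aboveApery-+*m (suc c) e (y + d * f′)
                     (aboveApery-weaken (+-monoˡ-≤ e d≤1+c) (aboveApery-+*fib d e y (suc (suc k)) ≤-refl above)))
    where
    -- Each of the d summands f (a-1) of f n costs one; the c + 1 ≥ d copies of f a pay for them.
    j c d f′ : ℕ
    j = n ∸ a
    c = fib (suc j)
    d = fib j
    f′ = fib (suc (suc k))
    d≤1+c : d ≤ suc c
    d≤1+c = ≤-trans (fib-≤-suc j) (n≤1+n c)
    fib-n : fib n ≡ c * m + d * f′
    fib-n = trans (cong fib (sym (m∸n+n≡m (≮⇒≥ n≮a)))) (fib-+ j (suc (suc k)))
    y+gen≡ : y + d * f′ + suc c * m ≡ y + gen n
    y+gen≡ = trans (solve 4 (λ Y W M X → Y :+ W :+ (M :+ X) := Y :+ (M :+ (X :+ W))) refl y (d * f′) m (c * m))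
               (cong (λ x → y + (m + x)) (sym fib-n))

  InS⇒aboveApery : ∀ y → InS a y → AboveApery 0 y
  InS⇒aboveApery y (ns , refl) = sums ns
    where
    sums : ∀ ns → AboveApery 0 (sum (map gen ns))
    sums [] = 0 , 0 , m>0 , refl , ≤-reflexive (zeck-0 a)
    sums (n ∷ ns) = subst (AboveApery 0) (+-comm (sum (map gen ns)) (gen n))
                      (aboveApery-+gen 0 (sum (map gen ns)) n (sums ns))

  quot-rem-unique : ∀ q r q′ r′ → r < m → r′ < m → q * m + r ≡ q′ * m + r′ → r ≡ r′ × q ≡ q′
  quot-rem-unique q r q′ r′ r<m r′<m eq =
    r≡r′ , *-cancelʳ-≡ q q′ m (+-cancelʳ-≡ r (q * m) (q′ * m) (trans eq (cong (q′ * m +_) (sym r≡r′))))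
    where
    rem : ∀ q r → r < m → (q * m + r) % m ≡ r
    rem q r r<m = trans (cong (_% m) (+-comm (q * m) r)) (trans ([m+kn]%n≡m%n r q m) (m<n⇒m%n≡m r<m))
    r≡r′ : r ≡ r′
    r≡r′ = trans (sym (rem q r r<m)) (trans (cong (_% m) eq) (rem q′ r′ r′<m))

  gapColumn : ℕ → List ℕ
  gapColumn r = map (λ q → q * m + r) (upTo (zeck a r))

  gaps : ℕ → List ℕ
  gaps zero = []
  gaps (suc j) = gaps j ++ gapColumn j

  length-gaps : ∀ j → length (gaps j) ≡ sumBelow j (zeck a)
  length-gaps zero = refl
  length-gaps (suc j) = trans (length-++ (gaps j))
    (cong₂ _+_ (length-gaps j) (trans (length-map _ (upTo (zeck a j))) (length-upTo (zeck a j))))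

  ∈-gaps⁺ : ∀ j q r → r < j → q < zeck a r → q * m + r ∈ gaps j
  ∈-gaps⁺ (suc j) q r r<1+j q<zeck with m<1+n⇒m<n∨m≡n r<1+j
  ... | inj₁ r<j = ∈-++⁺ˡ (∈-gaps⁺ j q r r<j q<zeck)
  ... | inj₂ refl = ∈-++⁺ʳ (gaps r) (∈-map⁺ (λ q → q * m + r) (∈-upTo⁺ q<zeck))

  ∈-gaps⁻ : ∀ j x → x ∈ gaps j → Σ ℕ λ q → Σ ℕ λ r → r < j × q < zeck a r × x ≡ q * m + r
  ∈-gaps⁻ (suc j) x x∈ with ∈-++⁻ (gaps j) x∈
  ... | inj₁ x∈gaps =
    let q , r , r<j , q<zeck , x≡ = ∈-gaps⁻ j x x∈gaps in q , r , m<n⇒m<1+n r<j , q<zeck , x≡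
  ... | inj₂ x∈column =
    let q , q∈ , x≡ = ∈-map⁻ (λ q → q * m + j) x∈column in q , j , ≤-refl , ∈-upTo⁻ q∈ , x≡

  gaps-unique : ∀ j → j ≤ m → Unique (gaps j)
  gaps-unique zero _ = AllPairs.[]
  gaps-unique (suc j) 1+j≤m =
    ++⁺ (gaps-unique j (≤-trans (n≤1+n j) 1+j≤m)) (map⁺ column-injective (upTo⁺ (zeck a j))) disjoint
    where
    column-injective : ∀ {q q′} → q * m + j ≡ q′ * m + j → q ≡ q′
    column-injective {q} {q′} eq = *-cancelʳ-≡ q q′ m (+-cancelʳ-≡ j (q * m) (q′ * m) eq)
    disjoint : ∀ {x} → ¬ (x ∈ gaps j × x ∈ gapColumn j)
    disjoint (x∈gaps , x∈column) with ∈-gaps⁻ j _ x∈gaps | ∈-map⁻ (λ q → q * m + j) x∈column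
    ... | q , r , r<j , _ , x≡ | q′ , _ , x≡′ =
      <⇒≢ r<j (proj₁ (quot-rem-unique q r q′ j (<-trans r<j 1+j≤m) 1+j≤m (trans (sym x≡) x≡′)))

  genus : HasGenus (InS a) (sumBelow m (zeck a))
  genus = gaps m , gaps-unique m ≤-refl , (λ x → mk⇔ (gap⇒∉S x) (∉S⇒gap x)) , length-gaps m
    where
    gap⇒∉S : ∀ x → x ∈ gaps m → ¬ InS a x
    gap⇒∉S x x∈ x∈S with ∈-gaps⁻ m x x∈ | InS⇒aboveApery x x∈S
    ... | q , r , r<m , q<zeck , x≡ | q′ , r′ , r′<m , x≡′ , zeck≤
          with quot-rem-unique q r q′ r′ r<m r′<m (trans (sym x≡) x≡′)
    ...   | refl , refl = <⇒≱ q<zeck (≤-trans zeck≤ (≤-reflexive (+-identityʳ q)))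
    ∉S⇒gap : ∀ x → ¬ InS a x → x ∈ gaps m
    ∉S⇒gap x x∉S = subst (_∈ gaps m) (sym x≡) (∈-gaps⁺ m (x / m) (x % m) (m%n<n x m) (≰⇒> zeck≰quot))
      where
      x≡ : x ≡ x / m * m + x % m
      x≡ = trans (m≡m%n+[m/n]*n x m) (+-comm (x % m) _)
      zeck≰quot : zeck a (x % m) ≰ x / m
      zeck≰quot zeck≤ = x∉S (subst (InS a) (sym x≡) (zeck≤quot⇒InS (x / m) (x % m) (m%n<n x m) zeck≤))

zeckTotal : ℕ → ℕ
zeckTotal a = sumBelow (fib a) (zeck a)

zeckTotal-rec : ∀ b → zeckTotal (suc (suc b)) ≡ zeckTotal (suc b) + (fib b + zeckTotal b)
zeckTotal-rec b = begin
  sumBelow (F + fib b) (zeck A)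
    ≡⟨ sumBelow-split (fib b) F (zeck A) ⟩
  sumBelow F (zeck A) + sumBelow (fib b) (λ i → zeck A (F + i))
    ≡⟨ cong₂ _+_ lower upper ⟩
  zeckTotal (suc b) + sumBelow (fib b) (λ i → suc (zeck b i))
    ≡⟨ cong (zeckTotal (suc b) +_) (sumBelow-suc (fib b) (zeck b)) ⟩
  zeckTotal (suc b) + (fib b + zeckTotal b) ∎
  where
  open ≡-Reasoning
  A F : ℕ
  A = suc (suc b)
  F = fib (suc b)
  lower : sumBelow F (zeck A) ≡ zeckTotal (suc b)
  lower = sumBelow-cong F (zeck A) (zeck (suc b)) (λ i i<F → zeck-< b i i<F)
  upper : sumBelow (fib b) (λ i → zeck A (F + i)) ≡ sumBelow (fib b) (λ i → suc (zeck b i))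
  upper = sumBelow-cong (fib b) _ _ λ i _ →
    trans (zeck-≥ b (F + i) (m≤m+n F i)) (cong (λ x → suc (zeck b x)) (m+n∸m≡n F i))

diagonalSum : ℕ → ℕ
diagonalSum n = sumBelow (suc n) (λ j → (n ∸ j) C j)

weightedDiagonalSum : ℕ → ℕ
weightedDiagonalSum n = sumBelow (suc n) (λ j → j * ((n ∸ j) C j))

0C[1+j]≡0 : ∀ j → 0 C suc j ≡ 0
0C[1+j]≡0 j = k>n⇒nCk≡0 {0} {suc j} (s≤s z≤n)

[n∸[1+n]]C[1+j]≡0 : ∀ n j → (n ∸ suc n) C suc j ≡ 0
[n∸[1+n]]C[1+j]≡0 n j = trans (cong (_C suc j) (m≤n⇒m∸n≡0 (n≤1+n n))) (0C[1+j]≡0 j)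

pascal-diagonal : ∀ n j → (suc n ∸ j) C suc j ≡ (n ∸ j) C j + (n ∸ j) C suc j
pascal-diagonal n j with j ≤? n
... | yes j≤n = trans (cong (_C suc j) (+-∸-assoc 1 j≤n)) (sym (nCk+nC[k+1]≡[n+1]C[k+1] (n ∸ j) j))
... | no j≰n with ≰⇒> j≰n
...   | s≤s {n = j′} n≤j′ = begin
  (suc n ∸ suc j′) C suc (suc j′)
    ≡⟨ cong (_C suc (suc j′)) (m≤n⇒m∸n≡0 n≤j′) ⟩
  0 C suc (suc j′)
    ≡⟨ 0C[1+j]≡0 (suc j′) ⟩
  0
    ≡⟨ sym (cong₂ _+_ (0C[1+j]≡0 j′) (0C[1+j]≡0 (suc j′))) ⟩
  0 C suc j′ + 0 C suc (suc j′)
    ≡⟨ cong (λ x → x C suc j′ + x C suc (suc j′)) (sym (m≤n⇒m∸n≡0 (m≤n⇒m≤1+n n≤j′))) ⟩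
  (n ∸ suc j′) C suc j′ + (n ∸ suc j′) C suc (suc j′) ∎
  where open ≡-Reasoning

diagonalSum-rec : ∀ n → diagonalSum (suc (suc n)) ≡ diagonalSum (suc n) + diagonalSum n
diagonalSum-rec n = begin
  diagonalSum (suc (suc n))
    ≡⟨ sumBelow-shift (suc (suc n)) (λ j → (suc (suc n) ∸ j) C j) ⟩
  1 + sumBelow (suc (suc n)) (λ j → (suc n ∸ j) C suc j)
    ≡⟨ cong (1 +_) (sumBelow-cong (suc (suc n)) _ _ (λ j _ → pascal-diagonal n j)) ⟩
  1 + sumBelow (suc (suc n)) (λ j → c j + c′ j)
    ≡⟨ cong (1 +_) (sumBelow-+ (suc (suc n)) c c′) ⟩
  1 + (sumBelow (suc (suc n)) c + sumBelow (suc (suc n)) c′)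
    ≡⟨ cong (1 +_) (cong₂ _+_ (sumBelow-last-0 (suc n) c ([n∸[1+n]]C[1+j]≡0 n n))
                               (sumBelow-last-0 (suc n) c′ ([n∸[1+n]]C[1+j]≡0 n (suc n)))) ⟩
  1 + (diagonalSum n + sumBelow (suc n) c′)
    ≡⟨ solve 3 (λ O D X → O :+ (D :+ X) := O :+ X :+ D) refl 1 (diagonalSum n) (sumBelow (suc n) c′) ⟩
  1 + sumBelow (suc n) c′ + diagonalSum n
    ≡⟨ cong (_+ diagonalSum n) (sym (sumBelow-shift (suc n) (λ j → (suc n ∸ j) C j))) ⟩
  diagonalSum (suc n) + diagonalSum n ∎
  where
  open ≡-Reasoning
  c c′ : ℕ → ℕ
  c j = (n ∸ j) C j
  c′ j = (n ∸ j) C suc j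

weightedDiagonalSum-rec : ∀ n → weightedDiagonalSum (suc (suc n)) ≡
                                diagonalSum n + weightedDiagonalSum n + weightedDiagonalSum (suc n)
weightedDiagonalSum-rec n = begin
  weightedDiagonalSum (suc (suc n))
    ≡⟨ sumBelow-shift (suc (suc n)) (λ j → j * ((suc (suc n) ∸ j) C j)) ⟩
  sumBelow (suc (suc n)) (λ j → suc j * ((suc n ∸ j) C suc j))
    ≡⟨ sumBelow-cong (suc (suc n)) _ _ (λ j _ →
         trans (cong (suc j *_) (pascal-diagonal n j)) (*-distribˡ-+ (suc j) (c j) (c′ j))) ⟩
  sumBelow (suc (suc n)) (λ j → (c j + j * c j) + suc j * c′ j)
    ≡⟨ sumBelow-+ (suc (suc n)) (λ j → c j + j * c j) (λ j → suc j * c′ j) ⟩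
  sumBelow (suc (suc n)) (λ j → c j + j * c j) + sumBelow (suc (suc n)) (λ j → suc j * c′ j)
    ≡⟨ cong (_+ sumBelow (suc (suc n)) (λ j → suc j * c′ j)) (sumBelow-+ (suc (suc n)) c (λ j → j * c j)) ⟩
  sumBelow (suc (suc n)) c + sumBelow (suc (suc n)) (λ j → j * c j) + sumBelow (suc (suc n)) (λ j → suc j * c′ j)
    ≡⟨ cong₂ _+_ (cong₂ _+_ unweighted weighted) shifted ⟩
  diagonalSum n + weightedDiagonalSum n + weightedDiagonalSum (suc n) ∎
  where
  open ≡-Reasoning
  c c′ : ℕ → ℕ
  c j = (n ∸ j) C j
  c′ j = (n ∸ j) C suc j
  unweighted : sumBelow (suc (suc n)) c ≡ diagonalSum n
  unweighted = sumBelow-last-0 (suc n) c ([n∸[1+n]]C[1+j]≡0 n n)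
  weighted : sumBelow (suc (suc n)) (λ j → j * c j) ≡ weightedDiagonalSum n
  weighted = sumBelow-last-0 (suc n) (λ j → j * c j)
    (trans (cong (suc n *_) ([n∸[1+n]]C[1+j]≡0 n n)) (*-zeroʳ (suc n)))
  shifted : sumBelow (suc (suc n)) (λ j → suc j * c′ j) ≡ weightedDiagonalSum (suc n)
  shifted = trans (sumBelow-last-0 (suc n) (λ j → suc j * c′ j)
                    (trans (cong (suc (suc n) *_) ([n∸[1+n]]C[1+j]≡0 n (suc n))) (*-zeroʳ (suc (suc n)))))
                  (sym (sumBelow-shift (suc n) (λ j → j * ((suc n ∸ j) C j))))

diagonalSum≡fib : ∀ n → diagonalSum n ≡ fib (suc n)
diagonalSum≡fib zero = refl
diagonalSum≡fib (suc zero) = refl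
diagonalSum≡fib (suc (suc n)) =
  trans (diagonalSum-rec n) (cong₂ _+_ (diagonalSum≡fib (suc n)) (diagonalSum≡fib n))

zeckTotal≡weightedDiagonalSum : ∀ n → zeckTotal (suc n) ≡ weightedDiagonalSum n
zeckTotal≡weightedDiagonalSum zero = refl
zeckTotal≡weightedDiagonalSum (suc zero) = refl
zeckTotal≡weightedDiagonalSum (suc (suc n)) = begin
  zeckTotal (3 + n)
    ≡⟨ zeckTotal-rec (suc n) ⟩
  zeckTotal (2 + n) + (fib (suc n) + zeckTotal (suc n))
    ≡⟨ cong₂ (λ x y → x + (y + zeckTotal (suc n)))
             (zeckTotal≡weightedDiagonalSum (suc n)) (sym (diagonalSum≡fib n)) ⟩
  weightedDiagonalSum (suc n) + (diagonalSum n + zeckTotal (suc n))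
    ≡⟨ cong (λ x → weightedDiagonalSum (suc n) + (diagonalSum n + x)) (zeckTotal≡weightedDiagonalSum n) ⟩
  weightedDiagonalSum (suc n) + (diagonalSum n + weightedDiagonalSum n)
    ≡⟨ +-comm (weightedDiagonalSum (suc n)) _ ⟩
  diagonalSum n + weightedDiagonalSum n + weightedDiagonalSum (suc n)
    ≡⟨ sym (weightedDiagonalSum-rec n) ⟩
  weightedDiagonalSum (2 + n) ∎
  where open ≡-Reasoning

sumFrom1≡sumBelow : ∀ l h → sumFrom1 l h ≡ sumBelow l (λ j → h (suc j))
sumFrom1≡sumBelow zero h = refl
sumFrom1≡sumBelow (suc l) h = cong (_+ h (suc l)) (sumFrom1≡sumBelow l h)

n/2≤j⇒n∸[1+j]<1+j : ∀ n j → n / 2 ≤ j → n ∸ suc j < suc j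
n/2≤j⇒n∸[1+j]<1+j n j n/2≤j with suc j ≤? n
... | yes 1+j≤n = m∸n<o 1+j≤n (begin-strict
  n                  ≡⟨ m≡m%n+[m/n]*n n 2 ⟩
  n % 2 + n / 2 * 2  <⟨ +-mono-<-≤ (m%n<n n 2) (*-monoˡ-≤ 2 n/2≤j) ⟩
  2 + j * 2          ≡⟨ solve 1 (λ j → con 2 :+ j :* con 2 := (con 1 :+ j) :+ (con 1 :+ j)) refl j ⟩
  suc j + suc j      ∎)
  where open ≤-Reasoning
... | no 1+j≰n = subst (_< suc j) (sym (m≤n⇒m∸n≡0 (<⇒≤ (≰⇒> 1+j≰n)))) (s≤s z≤n)

weightedDiagonalSum≡sumFrom1 : ∀ n → weightedDiagonalSum n ≡ sumFrom1 (n / 2) (λ i → i * ((n ∸ i) C i))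
weightedDiagonalSum≡sumFrom1 n = begin
  weightedDiagonalSum n  ≡⟨ sumBelow-shift n (λ j → j * ((n ∸ j) C j)) ⟩
  sumBelow n term        ≡⟨ sumBelow-tail-0 (n / 2) n term (m/n≤m n 2) term-vanishes ⟩
  sumBelow (n / 2) term  ≡⟨ sym (sumFrom1≡sumBelow (n / 2) (λ i → i * ((n ∸ i) C i))) ⟩
  sumFrom1 (n / 2) (λ i → i * ((n ∸ i) C i)) ∎
  where
  open ≡-Reasoning
  term : ℕ → ℕ
  term j = suc j * ((n ∸ suc j) C suc j)
  term-vanishes : ∀ j → n / 2 ≤ j → term j ≡ 0
  term-vanishes j n/2≤j = trans (cong (suc j *_) (k>n⇒nCk≡0 (n/2≤j⇒n∸[1+j]<1+j n j n/2≤j))) (*-zeroʳ (suc j))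

proposition32 : (a : ℕ) → 3 ≤ a → HasGenus (InS a) (genusFormula a)
proposition32 zero ()
proposition32 (suc zero) (s≤s ())
proposition32 (suc (suc zero)) (s≤s (s≤s ()))
proposition32 (suc (suc (suc k))) _ = subst (HasGenus (InS (3 + k))) genus≡formula (Apery.genus k)
  where
  genus≡formula : zeckTotal (3 + k) ≡ genusFormula (3 + k)
  genus≡formula = trans (zeckTotal≡weightedDiagonalSum (2 + k)) (weightedDiagonalSum≡sumFrom1 (2 + k))
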